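{- There is an absolute constant $c>0$ such that for every strategy $S$ and all integers $n\ge m\ge 1$ there exist ordered labeled trees $F$ and $G$ with $|F|=n$ and $|G|=m$ such that the number of relevant subproblems of $S$ on $(F,G)$ is at least $c\, m^2 n$.
   Context: Forests are finite ordered forests with vertex labels; $\emptyset$ is the empty forest. For a forest $F$ and $v\in F$, $F-v$ is the forest obtained by deleting $v$ (its children take its place, in order). $L_F,R_F$ denote the leftmost and rightmost trees of $F$, with roots $\ell_F,r_F$; $F-L_F$ and $F-R_F$ denote $F$ with that entire tree removed. A subforest of $F$ is any forest obtained from $F$ by a sequence of deletions of the leftmost or rightmost root. A strategy is a map $S$ assigning to each pair $(F',G')$ of forests a direction in $\{\mathsf{left},\mathsf{right}\}$. The set of relevant subproblems of $S$ on $(F,G)$ is the smallest set $P$ of pairs of forests with $(F,G)\in P$ and closed under: for $(F',G')\in P$ with $S(F',G')=\mathsf{right}$, $(F'-r_{F'},G')\in P$ if $F'\neq\emptyset$, $(F',G'-r_{G'})\in P$ if $G'\ne\emptyset$, and if both are nonempty also $(R_{F'}-r_{F'},R_{G'}-r_{G'})\in P$ and $(F'-R_{F'},G'-R_{G'})\in P$; and the same with $\ell, L$ (leftmost) in place of $r, R$ when $S(F',G')=\mathsf{left}$. All elements of $P$ are pairs of subforests of $F$ and $G$. -}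

module Defs where

open import Data.Nat using (ℕ; zero; suc; _+_)
open import Data.List using (List; []; _∷_; _++_; [_])
open import Data.Product using (_×_)
open import Relation.Binary.PropositionalEquality using (_≡_)

data Tree : Set where
  node : ℕ → List Tree → Tree

Forest : Set
Forest = List Tree

mutual
  sizeT : Tree → ℕ
  sizeT (node _ cs) = suc (sizeF cs)

  sizeF : Forest → ℕ
  sizeF []       = 0
  sizeF (t ∷ ts) = sizeT t + sizeF ts

data Dir : Set where
  left right : Dir

Strategy : Set
Strategy = Forest → Forest → Dir

-- Right operations on a nonempty forest  F₀ ++ [ node a cs ]:
--   F - r_F = F₀ ++ cs,  R_F - r_F = cs,  F - R_F = F₀.
-- Left operations on a nonempty forest  node a cs ∷ F₀:
--   F - ℓ_F = cs ++ F₀,  L_F - ℓ_F = cs,  F - L_F = F₀.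
data Relevant (S : Strategy) (F G : Forest) : Forest → Forest → Set where
  start : Relevant S F G F G
  rF : ∀ {F₀ a cs G'} → Relevant S F G (F₀ ++ [ node a cs ]) G' →
       S (F₀ ++ [ node a cs ]) G' ≡ right → Relevant S F G (F₀ ++ cs) G'
  rG : ∀ {F' G₀ b ds} → Relevant S F G F' (G₀ ++ [ node b ds ]) →
       S F' (G₀ ++ [ node b ds ]) ≡ right → Relevant S F G F' (G₀ ++ ds)
  rTrees : ∀ {F₀ a cs G₀ b ds} →
       Relevant S F G (F₀ ++ [ node a cs ]) (G₀ ++ [ node b ds ]) →
       S (F₀ ++ [ node a cs ]) (G₀ ++ [ node b ds ]) ≡ right →
       Relevant S F G cs ds
  rRest : ∀ {F₀ a cs G₀ b ds} →
       Relevant S F G (F₀ ++ [ node a cs ]) (G₀ ++ [ node b ds ]) →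
       S (F₀ ++ [ node a cs ]) (G₀ ++ [ node b ds ]) ≡ right →
       Relevant S F G F₀ G₀
  lF : ∀ {F₀ a cs G'} → Relevant S F G (node a cs ∷ F₀) G' →
       S (node a cs ∷ F₀) G' ≡ left → Relevant S F G (cs ++ F₀) G'
  lG : ∀ {F' G₀ b ds} → Relevant S F G F' (node b ds ∷ G₀) →
       S F' (node b ds ∷ G₀) ≡ left → Relevant S F G F' (ds ++ G₀)
  lTrees : ∀ {F₀ a cs G₀ b ds} →
       Relevant S F G (node a cs ∷ F₀) (node b ds ∷ G₀) →
       S (node a cs ∷ F₀) (node b ds ∷ G₀) ≡ left →
       Relevant S F G cs ds
  lRest : ∀ {F₀ a cs G₀ b ds} →
       Relevant S F G (node a cs ∷ F₀) (node b ds ∷ G₀) →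
       S (node a cs ∷ F₀) (node b ds ∷ G₀) ≡ left →
       Relevant S F G F₀ G₀

module Submission where

-- Let T be a right comb with p ≈ n/4 spine vertices, each carrying a leaf on its left, and U a left
-- comb with q ≈ m/4 spine vertices, both hanging from a long path; Tᵢ, Uⱼ are their subcombs with i
-- and j spine vertices. Whatever S does, (children Tᵢ, children Uⱼ) is relevant for all i ≤ p, j ≤ q.
-- If j = q, the second forest is the single tree U, so deleting roots of the first forest until Tᵢ is
-- outermost and then matching the outermost trees reaches the pair (symmetrically if i = p). Otherwise
-- (children Tᵢ₊₁, children Uⱼ₊₁) = ([leaf, Tᵢ], [Uⱼ, leaf]), and two deletions bring Tᵢ and Uⱼ face to
-- face. From each of these p q pairs, whichever direction S picks, one of its successors deletes a root
-- strictly between the two flanking leaves, which yields q + 1 pairs tagged by those leaves. Together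
-- with the n + 1 pairs (F′, [U]), needed when m is small, this gives n + p q (q + 1) = Ω(m² n) pairs.

open import Defs
open import Data.Nat using (ℕ; zero; suc; _+_; _*_; _∸_; _⊓_; _≤_; _<_; z≤n; s≤s)
open import Data.Nat.Properties
open import Data.Nat.DivMod using (_/_; _%_; m≡m%n+[m/n]*n; m%n<n; /-mono-≤)
open import Data.Nat.Induction using (<-wellFounded)
open import Data.Nat.Tactic.RingSolver using (solve-∀)
open import Data.List using (List; []; _∷_; _++_; [_]; length; initLast; _∷ʳ′_)
open import Data.List.Properties
  using (++-assoc; length-++; ∷-injectiveˡ; ∷-injectiveʳ; ∷ʳ-injectiveˡ; ∷ʳ-injectiveʳ)
open import Data.List.Relation.Unary.Any using (Any; here; there)
open import Data.List.Relation.Unary.Any.Properties using (++⁺ˡ; ++⁺ʳ; ++⁻)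
open import Data.List.Relation.Unary.All using (All; []; _∷_)
import Data.List.Relation.Unary.All as All
import Data.List.Relation.Unary.All.Properties as All
open import Data.List.Relation.Unary.AllPairs using ([]; _∷_)
open import Data.List.Relation.Unary.Unique.Propositional using (Unique)
import Data.List.Relation.Unary.Unique.Propositional.Properties as Unique
open import Data.Product using (Σ; ∃; _×_; _,_; proj₁; proj₂)
open import Data.Sum using (_⊎_; inj₁; inj₂)
open import Function using (flip; _∘_)
open import Induction.WellFounded using (Acc; acc)
open import Relation.Binary.PropositionalEquality
  using (_≡_; _≢_; refl; sym; trans; cong; cong₂; subst; module ≡-Reasoning)
open import Relation.Nullary using (¬_)

leaf : ℕ → Tree
leaf a = node a []

label : Tree → ℕ
label (node a _) = a

children : Tree → Forest
children (node _ cs) = cs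

sizeF-++ : ∀ X Y → sizeF (X ++ Y) ≡ sizeF X + sizeF Y
sizeF-++ []      Y = refl
sizeF-++ (t ∷ X) Y = trans (cong (sizeT t +_) (sizeF-++ X Y)) (sym (+-assoc (sizeT t) (sizeF X) (sizeF Y)))

sizeF-deleteˡ : ∀ a cs X → sizeF (node a cs ∷ X) ≡ suc (sizeF (cs ++ X))
sizeF-deleteˡ a cs X = cong suc (sym (sizeF-++ cs X))

sizeF-deleteʳ : ∀ X a cs → sizeF (X ++ [ node a cs ]) ≡ suc (sizeF (X ++ cs))
sizeF-deleteʳ X a cs = begin
  sizeF (X ++ [ node a cs ])      ≡⟨ sizeF-++ X [ node a cs ] ⟩
  sizeF X + (suc (sizeF cs) + 0)  ≡⟨ cong (λ k → sizeF X + suc k) (+-identityʳ (sizeF cs)) ⟩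
  sizeF X + suc (sizeF cs)        ≡⟨ +-suc (sizeF X) (sizeF cs) ⟩
  suc (sizeF X + sizeF cs)        ≡⟨ cong suc (sym (sizeF-++ X cs)) ⟩
  suc (sizeF (X ++ cs))           ∎
  where open ≡-Reasoning

data _⊑_ (t : Tree) : Tree → Set where
  ⊑-refl  : t ⊑ t
  ⊑-child : ∀ {a cs} → Any (t ⊑_) cs → t ⊑ node a cs

_⊑*_ : Tree → Forest → Set
t ⊑* X = Any (t ⊑_) X

⊑*-deleteˡ : ∀ {t a cs X} → t ⊑* (node a cs ∷ X) → t ≡ node a cs ⊎ t ⊑* (cs ++ X)
⊑*-deleteˡ         (here ⊑-refl)      = inj₁ refl
⊑*-deleteˡ         (here (⊑-child o)) = inj₂ (++⁺ˡ o)
⊑*-deleteˡ {cs = cs} (there o)        = inj₂ (++⁺ʳ cs o)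

⊑*-deleteʳ : ∀ {t a cs} X → t ⊑* (X ++ [ node a cs ]) → t ≡ node a cs ⊎ t ⊑* (X ++ cs)
⊑*-deleteʳ X o with ++⁻ X o
... | inj₁ o′                 = inj₂ (++⁺ˡ o′)
... | inj₂ (here ⊑-refl)      = inj₁ refl
... | inj₂ (here (⊑-child o′)) = inj₂ (++⁺ʳ X o′)

Relevant-swap : ∀ {S F G X Y} → Relevant S F G X Y → Relevant (flip S) G F Y X
Relevant-swap start = start
Relevant-swap (rF {F₀} {a} {cs} {G'} r eq) = rG {F' = G'} {G₀ = F₀} {b = a} {ds = cs} (Relevant-swap r) eq
Relevant-swap (rG {F'} {G₀} {b} {ds} r eq) = rF {F₀ = G₀} {a = b} {cs = ds} {G' = F'} (Relevant-swap r) eq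
Relevant-swap (rTrees {F₀} {a} {cs} {G₀} {b} {ds} r eq) =
  rTrees {F₀ = G₀} {a = b} {cs = ds} {G₀ = F₀} {b = a} {ds = cs} (Relevant-swap r) eq
Relevant-swap (rRest {F₀} {a} {cs} {G₀} {b} {ds} r eq) =
  rRest {F₀ = G₀} {a = b} {cs = ds} {G₀ = F₀} {b = a} {ds = cs} (Relevant-swap r) eq
Relevant-swap (lF r eq)     = lG (Relevant-swap r) eq
Relevant-swap (lG r eq)     = lF (Relevant-swap r) eq
Relevant-swap (lTrees r eq) = lTrees (Relevant-swap r) eq
Relevant-swap (lRest r eq)  = lRest (Relevant-swap r) eq

module _ {S : Strategy} {F G : Forest} where

  Relevant-unwrap : ∀ {u v} → Relevant S F G [ u ] [ v ] → Relevant S F G (children u) (children v)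
  Relevant-unwrap {node a cs} {node b ds} r with S [ node a cs ] [ node b ds ] in eq
  ... | left  = lTrees r eq
  ... | right = rTrees {F₀ = []} {G₀ = []} r eq

  Relevant-unwrapˡ : ∀ {u v b} → Relevant S F G [ u ] (v ∷ leaf b ∷ []) →
                     Relevant S F G (children u) (children v)
  Relevant-unwrapˡ {node a cs} {node c ds} {b} r with S [ node a cs ] (node c ds ∷ leaf b ∷ []) in eq
  ... | left  = lTrees r eq
  ... | right = Relevant-unwrap (rG {G₀ = [ node c ds ]} r eq)

  Relevant-unwrapʳ : ∀ {a u v} → Relevant S F G (leaf a ∷ u ∷ []) [ v ] →
                     Relevant S F G (children u) (children v)
  Relevant-unwrapʳ {a} {node b cs} {node c ds} r with S (leaf a ∷ node b cs ∷ []) [ node c ds ] in eq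
  ... | left  = Relevant-unwrap (lF r eq)
  ... | right = rTrees {F₀ = [ leaf a ]} {G₀ = []} r eq

  Relevant-diagonal : ∀ {a b u v} → Relevant S F G (leaf a ∷ u ∷ []) (v ∷ leaf b ∷ []) →
                      Relevant S F G (children u) (children v)
  Relevant-diagonal {a} {b} {u} {v} r with S (leaf a ∷ u ∷ []) (v ∷ leaf b ∷ []) in eq
  ... | left  = Relevant-unwrapˡ (lF r eq)
  ... | right = Relevant-unwrapʳ (rG {G₀ = [ v ]} r eq)

  Relevant-subtree : ∀ {X g t} → Relevant S F G X [ g ] → t ⊑* X → Relevant S F G (children t) (children g)
  Relevant-subtree {X} {node c ws} {t} = go X (<-wellFounded (sizeF X))
    where
    go : ∀ X → Acc _<_ (sizeF X) → Relevant S F G X [ node c ws ] → t ⊑* X → Relevant S F G (children t) ws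
    go X (acc rs) r o with S X [ node c ws ] in eq
    go (node a cs ∷ X) (acc rs) r o | left with ⊑*-deleteˡ o
    ... | inj₁ refl = lTrees r eq
    ... | inj₂ o′   = go (cs ++ X) (rs (≤-reflexive (sym (sizeF-deleteˡ a cs X)))) (lF r eq) o′
    go X (acc rs) r o | right with initLast X
    go .[] _ _ () | right | []
    ... | X₀ ∷ʳ′ node a cs with ⊑*-deleteʳ X₀ o
    ...   | inj₁ refl = rTrees {G₀ = []} r eq
    ...   | inj₂ o′   = go (X₀ ++ cs) (rs (≤-reflexive (sym (sizeF-deleteʳ X₀ a cs)))) (rF r eq) o′

Pair : Set
Pair = Forest × Forest

Flanked : Tree → Tree → Pair → Set
Flanked y x π = ∃ λ (XY : Pair) → π ≡ (y ∷ proj₁ XY , proj₂ XY ++ [ x ])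

Flanked-injective : ∀ {y x y′ x′ π} → Flanked y x π → Flanked y′ x′ π → y ≡ y′ × x ≡ x′
Flanked-injective ((_ , Y) , refl) ((_ , Y′) , e) =
  ∷-injectiveˡ (cong proj₁ e) , ∷ʳ-injectiveʳ Y Y′ (cong proj₂ e)

module Families (S : Strategy) (F G : Forest) where

  RelevantPair : Pair → Set
  RelevantPair π = Relevant S F G (proj₁ π) (proj₂ π)

  record Family (Φ : Pair → Set) (k : ℕ) : Set where
    constructor family
    field
      pairs     : List Pair
      relevant  : All RelevantPair pairs
      unique    : Unique pairs
      satisfies : All Φ pairs
      large     : k ≤ length pairs

  private
    variable
      Φ Ψ : Pair → Set
      k l : ℕ

  map : (∀ {π} → Φ π → Ψ π) → Family Φ k → Family Ψ k
  map f (family ps rs us φs k≤) = family ps rs us (All.map f φs) k≤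

  weaken : l ≤ k → Family Φ k → Family Φ l
  weaken l≤k (family ps rs us φs k≤) = family ps rs us φs (≤-trans l≤k k≤)

  empty : Family Φ 0
  empty = family [] [] [] [] z≤n

  singleton : ∀ {π} → RelevantPair π → Φ π → Family Φ 1
  singleton r φ = family [ _ ] (r ∷ []) ([] ∷ []) (φ ∷ []) ≤-refl

  extend : ∀ {π} → RelevantPair π → Φ π → Family (λ ρ → Φ ρ × ρ ≢ π) k → Family Φ (suc k)
  extend r φ (family ps rs us φs k≤) =
    family (_ ∷ ps) (r ∷ rs) (All.map (λ φ≢ → proj₂ φ≢ ∘ sym) φs ∷ us)
      (φ ∷ All.map proj₁ φs) (s≤s k≤)

  union : Family Φ k → Family Ψ l → (∀ {π} → Φ π → ¬ Ψ π) → Family (λ π → Φ π ⊎ Ψ π) (k + l)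
  union (family ps rs us φs k≤) (family qs rs′ us′ ψs l≤) disjoint =
    family (ps ++ qs) (All.++⁺ rs rs′)
      (Unique.++⁺ us us′ λ (∈ps , ∈qs) → disjoint (All.lookup φs ∈ps) (All.lookup ψs ∈qs))
      (All.++⁺ (All.map inj₁ φs) (All.map inj₂ ψs))
      (≤-trans (+-mono-≤ k≤ l≤) (≤-reflexive (sym (length-++ ps))))

  ⋃ : (N : ℕ) (Φ : ℕ → Pair → Set) → (∀ {i j π} → Φ i π → Φ j π → i ≡ j) →
      (∀ i → i < N → Family (Φ i) k) → Family (λ π → ∃ λ i → i < N × Φ i π) (N * k)
  ⋃ zero    Φ _   _   = empty
  ⋃ (suc N) Φ inj fam =
    map (λ { (inj₁ φ) → N , ≤-refl , φ ; (inj₂ (i , i<N , φ)) → i , m≤n⇒m≤1+n i<N , φ })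
      (union (fam N ≤-refl) (⋃ N Φ inj λ i i<N → fam i (m≤n⇒m≤1+n i<N))
        λ φN (i , i<N , φi) → <-irrefl (inj φi φN) i<N)

  -- A walk through relevant subproblems along which the measure μ strictly decreases never revisits a pair.
  descend : {A : Set} (pair : A → Pair) → (∀ {a a′} → pair a ≡ pair a′ → a ≡ a′) →
    (μ len : A → ℕ) →
    (∀ a → RelevantPair (pair a) →
       len a ≡ 0 ⊎ ∃ λ a′ → RelevantPair (pair a′) × μ a′ < μ a × len a ≤ suc (len a′)) →
    ∀ a → RelevantPair (pair a) → Family (λ π → ∃ λ a′ → π ≡ pair a′) (suc (len a))
  descend pair pair-injective μ len step a = map (λ (a′ , e , _) → a′ , e) ∘ go a (<-wellFounded (μ a))
    where
    go : ∀ a → Acc _<_ (μ a) → RelevantPair (pair a) →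
         Family (λ π → ∃ λ a′ → π ≡ pair a′ × μ a′ ≤ μ a) (suc (len a))
    go a (acc rs) r with step a r
    ... | inj₁ len≡0 = weaken (≤-reflexive (cong suc len≡0)) (singleton r (a , refl , ≤-refl))
    ... | inj₂ (a′ , r′ , μ< , len≤) =
      weaken (s≤s len≤) (extend r (a , refl , ≤-refl) (map below (go a′ (rs μ<) r′)))
      where
      below : ∀ {π} → (∃ λ b → π ≡ pair b × μ b ≤ μ a′) →
              (∃ λ b → π ≡ pair b × μ b ≤ μ a) × π ≢ pair a
      below (b , refl , μb≤) = (b , refl , ≤-trans μb≤ (<⇒≤ μ<)) ,
        λ e → <-irrefl (cong μ (pair-injective e)) (≤-<-trans μb≤ μ<)

  stripFirst : ∀ {X Y} → RelevantPair (X , Y) → Family (λ π → ∃ λ X′ → π ≡ (X′ , Y)) (suc (sizeF X))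
  stripFirst {X} {Y} = descend (_, Y) (cong proj₁) sizeF sizeF step X
    where
    shrink : ∀ {m n} → m ≡ suc n → n < m × m ≤ suc n
    shrink refl = ≤-refl , ≤-refl

    step : ∀ X → RelevantPair (X , Y) →
           sizeF X ≡ 0 ⊎ ∃ λ X′ → RelevantPair (X′ , Y) × sizeF X′ < sizeF X × sizeF X ≤ suc (sizeF X′)
    step X r with S X Y in eq
    step []              r | left = inj₁ refl
    step (node a cs ∷ X) r | left = inj₂ (cs ++ X , lF r eq , shrink (sizeF-deleteˡ a cs X))
    step X r | right with initLast X
    ... | []               = inj₁ refl
    ... | X₀ ∷ʳ′ node a cs = inj₂ (X₀ ++ cs , rF r eq , shrink (sizeF-deleteʳ X₀ a cs))

  peelInside : ∀ y x {X Y} → RelevantPair (y ∷ X , Y ++ [ x ]) → Family (Flanked y x) (suc (sizeF X ⊓ sizeF Y))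
  peelInside y x {X} {Y} = descend framed framed-injective inner shorter step (X , Y)
    where
    framed : Pair → Pair
    framed (X , Y) = y ∷ X , Y ++ [ x ]

    framed-injective : ∀ {a b} → framed a ≡ framed b → a ≡ b
    framed-injective {_ , Y} {_ , Y′} e =
      cong₂ _,_ (∷-injectiveʳ (cong proj₁ e)) (∷ʳ-injectiveˡ Y Y′ (cong proj₂ e))

    inner shorter : Pair → ℕ
    inner   (X , Y) = sizeF X + sizeF Y
    shorter (X , Y) = sizeF X ⊓ sizeF Y

    shrinkˡ : ∀ {m m′ n} → m ≡ suc m′ → m′ + n < m + n × m ⊓ n ≤ suc (m′ ⊓ n)
    shrinkˡ {m′ = m′} {n} refl = ≤-refl , ⊓-monoʳ-≤ (suc m′) (n≤1+n n)

    shrinkʳ : ∀ {m n n′} → n ≡ suc n′ → m + n′ < m + n × m ⊓ n ≤ suc (m ⊓ n′)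
    shrinkʳ {m} {n′ = n′} refl = ≤-reflexive (sym (+-suc m n′)) , ⊓-monoˡ-≤ (suc n′) (n≤1+n m)

    step : ∀ a → RelevantPair (framed a) →
           shorter a ≡ 0 ⊎
           ∃ λ a′ → RelevantPair (framed a′) × inner a′ < inner a × shorter a ≤ suc (shorter a′)
    step (X , Y) r with S (y ∷ X) (Y ++ [ x ]) in eq
    step (X , [])              r | left = inj₁ (⊓-zeroʳ (sizeF X))
    step (X , node b ds ∷ Y) r | left =
      inj₂ ((X , ds ++ Y) , subst (Relevant S F G (y ∷ X)) (sym (++-assoc ds Y [ x ])) (lG r eq) ,
            shrinkʳ (sizeF-deleteˡ b ds Y))
    step (X , Y) r | right with initLast X
    ... | []               = inj₁ refl
    ... | X₀ ∷ʳ′ node a cs =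
      inj₂ ((X₀ ++ cs , Y) , rF {F₀ = y ∷ X₀} r eq , shrinkˡ (sizeF-deleteʳ X₀ a cs))

path : ℕ → Tree
path zero    = leaf 0
path (suc k) = node 0 [ path k ]

-- Leaves carry labels ≥ 1 and every other vertex label 0, so a leaf determines its position and
-- differs from every comb.
rightComb : ℕ → ℕ → Tree
rightComb L zero    = path L
rightComb L (suc i) = node 0 (leaf (suc i) ∷ rightComb L i ∷ [])

leftComb : ℕ → ℕ → Tree
leftComb L zero    = path L
leftComb L (suc j) = node 0 (leftComb L j ∷ leaf (suc j) ∷ [])

sizeT-path : ∀ L → sizeT (path L) ≡ suc L
sizeT-path zero    = refl
sizeT-path (suc L) = cong suc (trans (+-identityʳ (sizeT (path L))) (sizeT-path L))

sizeT-rightComb : ∀ L i → sizeT (rightComb L i) ≡ 2 * i + suc L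
sizeT-rightComb L zero    = sizeT-path L
sizeT-rightComb L (suc i) = trans (cong (λ s → suc (suc (s + 0))) (sizeT-rightComb L i)) (identity i L)
  where
  identity : ∀ i L → suc (suc (2 * i + suc L + 0)) ≡ 2 * suc i + suc L
  identity = solve-∀

sizeT-leftComb : ∀ L j → sizeT (leftComb L j) ≡ 2 * j + suc L
sizeT-leftComb L zero    = sizeT-path L
sizeT-leftComb L (suc j) = trans (cong (λ s → suc (s + 1)) (sizeT-leftComb L j)) (identity j L)
  where
  identity : ∀ j L → suc (2 * j + suc L + 1) ≡ 2 * suc j + suc L
  identity = solve-∀

label-path : ∀ L → label (path L) ≡ 0
label-path zero    = refl
label-path (suc L) = refl

label-leftComb : ∀ L j → label (leftComb L j) ≡ 0
label-leftComb L zero    = label-path L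
label-leftComb L (suc j) = refl

rightComb-⊑ : ∀ L a i → rightComb L i ⊑ rightComb L (a + i)
rightComb-⊑ L zero    i = ⊑-refl
rightComb-⊑ L (suc a) i = ⊑-child (there (here (rightComb-⊑ L a i)))

leftComb-⊑ : ∀ L b j → leftComb L j ⊑ leftComb L (b + j)
leftComb-⊑ L zero    j = ⊑-refl
leftComb-⊑ L (suc b) j = ⊑-child (here (leftComb-⊑ L b j))

module HardInstance (S : Strategy) (L L′ p q : ℕ) (q≤p : q ≤ p) (q≤L : q ≤ L) (q≤L′ : q ≤ L′) where

  T U : Tree
  T = rightComb L p
  U = leftComb L′ q

  open Families S [ T ] [ U ] public

  Corner : ℕ → ℕ → Set
  Corner i j = RelevantPair (children (rightComb L i) , children (leftComb L′ j))

  corner-maxʳ : ∀ a i → a + i ≡ p → Corner i q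
  corner-maxʳ a i e =
    Relevant-subtree start (here (subst (λ k → rightComb L i ⊑ rightComb L k) e (rightComb-⊑ L a i)))

  corner-maxˡ : ∀ b j → b + j ≡ q → Corner p j
  corner-maxˡ b j e =
    Relevant-swap (Relevant-subtree start
      (here (subst (λ k → leftComb L′ j ⊑ leftComb L′ k) e (leftComb-⊑ L′ b j))))

  corner : ∀ a b i j → a + i ≡ p → b + j ≡ q → Corner i j
  corner zero    b       i j e f = subst (λ i → Corner i j) (sym e) (corner-maxˡ b j f)
  corner (suc a) zero    i j e f = subst (Corner i) (sym f) (corner-maxʳ (suc a) i e)
  corner (suc a) (suc b) i j e f =
    Relevant-diagonal (corner a b (suc i) (suc j) (trans (+-suc a i) e) (trans (+-suc b j) f))

  block : ∀ i j → i < p → j < q → Family (Flanked (leaf (suc i)) (leaf (suc j))) (suc q)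
  block i j i<p j<q =
    weaken (s≤s (⊓-glb (q≤sizeF (sizeT-rightComb L i) q≤L) (q≤sizeF (sizeT-leftComb L′ j) q≤L′)))
      (peelInside (leaf (suc i)) (leaf (suc j)) {[ rightComb L i ]} {[ leftComb L′ j ]}
        (corner (p ∸ suc i) (q ∸ suc j) (suc i) (suc j) (m∸n+n≡m i<p) (m∸n+n≡m j<q)))
    where
    q≤sizeF : ∀ {t M k} → sizeT t ≡ k + suc M → q ≤ M → q ≤ sizeF [ t ]
    q≤sizeF {t} {M} {k} e q≤M = begin
      q           ≤⟨ q≤M ⟩
      M           ≤⟨ n≤1+n M ⟩
      suc M       ≤⟨ m≤n+m (suc M) k ⟩
      k + suc M   ≡⟨ sym e ⟩
      sizeT t     ≤⟨ m≤m+n (sizeT t) 0 ⟩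
      sizeF [ t ] ∎
      where open ≤-Reasoning

  InGrid : Pair → Set
  InGrid π = ∃ λ i → i < p × ∃ λ j → j < q × Flanked (leaf (suc i)) (leaf (suc j)) π

  grid : Family InGrid (p * (q * suc q))
  grid = ⋃ p (λ i π → ∃ λ j → j < q × Flanked (leaf (suc i)) (leaf (suc j)) π) sameRow
           λ i i<p → ⋃ q (λ j → Flanked (leaf (suc i)) (leaf (suc j))) sameColumn (λ j → block i j i<p)
    where
    leaf-injective : ∀ {i j} → leaf (suc i) ≡ leaf (suc j) → i ≡ j
    leaf-injective = suc-injective ∘ cong label

    sameRow : ∀ {i i′ π} → (∃ λ j → j < q × Flanked (leaf (suc i)) (leaf (suc j)) π) →
              (∃ λ j → j < q × Flanked (leaf (suc i′)) (leaf (suc j)) π) → i ≡ i′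
    sameRow (_ , _ , f) (_ , _ , f′) = leaf-injective (proj₁ (Flanked-injective f f′))

    sameColumn : ∀ {i j j′ π} → Flanked (leaf (suc i)) (leaf (suc j)) π →
                 Flanked (leaf (suc i)) (leaf (suc j′)) π → j ≡ j′
    sameColumn f f′ = leaf-injective (proj₂ (Flanked-injective f f′))

  relevantPairs : Family (λ π → (∃ λ X → π ≡ (X , [ U ])) ⊎ InGrid π) (suc (sizeF [ T ]) + p * (q * suc q))
  relevantPairs = union (stripFirst start) grid λ { (_ , refl) (_ , _ , _ , _ , (_ , Y) , e) →
    0≢1+n (trans (sym (label-leftComb L′ q)) (cong label (∷ʳ-injectiveʳ [] Y (cong proj₂ e)))) }

padding : ℕ → ℕ
padding n = n % 4 + 2 * (n / 4)

quarter≤padding : ∀ n → n / 4 ≤ padding n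
quarter≤padding n = ≤-trans (m≤m+n (n / 4) (n / 4 + 0)) (m≤n+m (2 * (n / 4)) (n % 4))

padding-fits : ∀ n → 2 * (n / 4) + suc (padding n) ≡ suc n
padding-fits n = trans (identity (n / 4) (n % 4)) (cong suc (sym (m≡m%n+[m/n]*n n 4)))
  where
  identity : ∀ q r → 2 * q + suc (r + 2 * q) ≡ suc (r + q * 4)
  identity = solve-∀

suc≤4+quarter*4 : ∀ n → suc n ≤ 4 + n / 4 * 4
suc≤4+quarter*4 n =
  subst (λ k → suc k ≤ 4 + n / 4 * 4) (sym (m≡m%n+[m/n]*n n 4)) (+-monoˡ-≤ (n / 4 * 4) (m%n<n n 4))

cubeBound : ∀ {m n q p c} → m ≤ 4 + q * 4 → n ≤ 4 + p * 4 → q ≤ p → n + p * (q * suc q) ≤ c →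
            m * m * n ≤ 512 * c
cubeBound {m} {n} {zero} {c = c} m≤4 _ _ n+≤c = begin
  m * m * n  ≤⟨ *-monoˡ-≤ n (*-mono-≤ m≤4 m≤4) ⟩
  16 * n     ≤⟨ *-monoˡ-≤ n (m≤m+n 16 496) ⟩
  512 * n    ≤⟨ *-monoʳ-≤ 512 (≤-trans (m≤m+n n _) n+≤c) ⟩
  512 * c    ∎
  where open ≤-Reasoning
cubeBound {q = suc _} {zero} _ _ () _
cubeBound {m} {n} {suc q} {suc p} {c} m≤ n≤ _ n+≤c = begin
  m * m * n                              ≤⟨ *-mono-≤ (*-mono-≤ (≤8* {q} m≤) (≤8* {q} m≤)) (≤8* {p} n≤) ⟩
  8 * suc q * (8 * suc q) * (8 * suc p)  ≡⟨ identity q p ⟩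
  512 * (suc p * (suc q * suc q))        ≤⟨ *-monoʳ-≤ 512 (*-monoʳ-≤ (suc p) (*-monoʳ-≤ (suc q) (n≤1+n (suc q)))) ⟩
  512 * (suc p * (suc q * suc (suc q)))  ≤⟨ *-monoʳ-≤ 512 (≤-trans (m≤n+m _ n) n+≤c) ⟩
  512 * c                                ∎
  where
  open ≤-Reasoning

  identity : ∀ q p → 8 * suc q * (8 * suc q) * (8 * suc p) ≡ 512 * (suc p * (suc q * suc q))
  identity = solve-∀

  ≤8* : ∀ {k a} → a ≤ 4 + suc k * 4 → a ≤ 8 * suc k
  ≤8* {k} a≤ = ≤-trans a≤ (≤-trans (m≤m+n (4 + suc k * 4) (k * 4)) (≤-reflexive (split k)))
    where
    split : ∀ k → 4 + suc k * 4 + k * 4 ≡ 8 * suc k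
    split = solve-∀

ManyRelevant : Strategy → ℕ → ℕ → ℕ → Set
ManyRelevant S n m c = Σ Tree λ T → Σ Tree λ U → sizeT T ≡ n × sizeT U ≡ m ×
  Σ (List (Forest × Forest)) λ xs →
    Unique xs × All (λ p → Relevant S [ T ] [ U ] (proj₁ p) (proj₂ p)) xs × m * m * n ≤ c * length xs

hardInstance : ∀ S n m → m ≤ n → ManyRelevant S (suc n) (suc m) 512
hardInstance S n m m≤n =
  T , U , sizeT-T , sizeT-U , pairs , unique , relevant ,
  cubeBound (suc≤4+quarter*4 m) (suc≤4+quarter*4 n) q≤p count
  where
  p q : ℕ
  p = n / 4
  q = m / 4

  q≤p : q ≤ p
  q≤p = /-mono-≤ m≤n (≤-refl {4})

  open HardInstance S (padding n) (padding m) p q q≤p (≤-trans q≤p (quarter≤padding n)) (quarter≤padding m)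
  open Family relevantPairs

  sizeT-T : sizeT T ≡ suc n
  sizeT-T = trans (sizeT-rightComb (padding n) p) (padding-fits n)

  sizeT-U : sizeT U ≡ suc m
  sizeT-U = trans (sizeT-leftComb (padding m) q) (padding-fits m)

  count : suc n + p * (q * suc q) ≤ length pairs
  count = begin
    suc n + p * (q * suc q)              ≤⟨ +-monoˡ-≤ (p * (q * suc q)) (n≤1+n (suc n)) ⟩
    suc (suc n) + p * (q * suc q)        ≡⟨ cong (λ k → suc k + p * (q * suc q)) (sym sizeF-[T]) ⟩
    suc (sizeF [ T ]) + p * (q * suc q)  ≤⟨ large ⟩
    length pairs                         ∎
    where
    open ≤-Reasoning
    sizeF-[T] : sizeF [ T ] ≡ suc n
    sizeF-[T] = trans (+-identityʳ (sizeT T)) sizeT-T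

lemma4 : Σ ℕ λ k → (S : Strategy) (n m : ℕ) → 1 ≤ m → m ≤ n →
    Σ Tree λ T → Σ Tree λ U → sizeT T ≡ n × sizeT U ≡ m ×
      Σ (List (Forest × Forest)) λ xs →
        Unique xs × All (λ p → Relevant S [ T ] [ U ] (proj₁ p) (proj₂ p)) xs ×
        m * m * n ≤ suc k * length xs
lemma4 = 511 , λ where
  S (suc n) (suc m) _ (s≤s m≤n) → hardInstance S n m m≤n
  S n       zero    () _
  S zero    (suc m) _ ()
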